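{- Let $\phi = C_1 \wedge \dots \wedge C_m$, with $m \geq 2$, be a 3-CNF formula, where $C_j = (\ell^j_1 \vee \ell^j_2 \vee \ell^j_3)$ for $1 \le j \le m$, and let $G$ be the graph associated with $\phi$ as described in the context. If $S$ is an inclusion-wise minimal separator of $G$ with $|S| \geq 4$, then $S \subseteq \{c_j, u^j_i, w^j_i : 1 \le i \le 3,\ 1 \le j \le m\}$ and $\phi$ is satisfiable.
   Context: Graphs are simple (no loops, no parallel edges). For a graph $G=(V,E)$ and vertices $a,b$, an $a$-$b$ separator is a set $S \subseteq V$, with $a,b \notin S$, such that $a$ and $b$ lie in different connected components of $G - S$. A set $S$ is a separator if it is an $a$-$b$ separator for some $a,b \in V$. An inclusion-wise minimal separator is a separator $S$ such that no proper subset of $S$ is a separator. Construction of $G$ from $\phi$. $G$ has two special vertices $a$ and $b$. For each clause $C_j$, $1\le j\le m$, create three induced paths $u^j_i v^j_i w^j_i$ ($i=1,2,3$) on three vertices each, and an extra vertex $c_j$. The vertex $a$ is adjacent to $u^j_1,u^j_2,u^j_3$, and $b$ is adjacent to $w^j_1,w^j_2,w^j_3$. For each $i \in \{1,2,3\}$, $c_j$ is made adjacent to $u^j_i$ if $\ell^j_i$ is a negative literal, and to $w^j_i$ if $\ell^j_i$ is a positive literal. The vertices $v^j_i$ are called middle vertices, and $V_1$ denotes the set of all vertices $u^j_i, v^j_i, w^j_i, c_j$. A pair $u^j_i, w^{j'}_{i'}$ (with $i,i' \in\{1,2,3\}$, $j,j' \in \{1,\dots,m\}$ not necessarily distinct)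 is called conflicting if $\ell^j_i$ and $\ell^{j'}_{i'}$ are literals of the same variable (i.e. $\ell^j_i=\ell^{j'}_{i'}$ or $\ell^j_i = \overline{\ell^{j'}_{i'}}$); pairs of two $u$-vertices or of two $w$-vertices are never conflicting. For every conflicting pair $u^j_i, w^{j'}_{i'}$ with $j \neq j'$, add a new vertex $y$ adjacent exactly to $u^j_i$ and $w^{j'}_{i'}$; let $V_2$ be the set of these vertices. Finally, to each vertex not in $V_1$ (that is, to $a$, $b$, and each vertex of $V_2$) and to each middle vertex $v^j_i$, attach a new pendant vertex (a new vertex of degree one adjacent only to it). There are no other vertices or edges. -}

module Defs where

open import Data.Nat using (ℕ; _≡ᵇ_)
open import Data.Bool using (Bool; true; false; T; not; _∧_)
open import Data.Fin using (Fin)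
open import Data.Fin.Properties using (_≟_)
open import Data.Product using (Σ; _×_; _,_; ∃)
open import Data.Sum using (_⊎_)
open import Relation.Nullary using (¬_)
open import Relation.Nullary.Decidable using (⌊_⌋)
open import Relation.Binary.PropositionalEquality using (_≡_; _≢_)

record Literal : Set where
  constructor lit
  field
    var : ℕ
    positive : Bool
open Literal public

-- A 3-CNF formula with m clauses: clause j is ℓ^j_1 ∨ ℓ^j_2 ∨ ℓ^j_3,
-- given by the literal (φ j i), i ∈ Fin 3.
CNF3 : ℕ → Set
CNF3 m = Fin m → Fin 3 → Literal

Assignment : Set
Assignment = ℕ → Bool

evalLit : Assignment → Literal → Bool
evalLit σ (lit x true)  = σ x
evalLit σ (lit x false) = not (σ x)

Satisfiable : ∀ {m} → CNF3 m → Set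
Satisfiable {m} φ = Σ Assignment λ σ → (j : Fin m) → Σ (Fin 3) λ i → evalLit σ (φ j i) ≡ true

-- The pair u^j_i, w^{j'}_{i'} is conflicting (literals of the same variable)
-- and j ≠ j': exactly then a vertex y is added.
yCond : ∀ {m} → CNF3 m → Fin m → Fin 3 → Fin m → Fin 3 → Bool
yCond φ j i j' i' = (var (φ j i) ≡ᵇ var (φ j' i')) ∧ not ⌊ j ≟ j' ⌋

data Vertex {m : ℕ} (φ : CNF3 m) : Set where
  va vb    : Vertex φ
  pa pb    : Vertex φ                           -- pendants of a, b
  u v w    : Fin m → Fin 3 → Vertex φ
  pv       : Fin m → Fin 3 → Vertex φ           -- pendant of the middle vertex v^j_i
  c        : Fin m → Vertex φ
  y        : (j : Fin m) (i : Fin 3) (j' : Fin m) (i' : Fin 3) →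
             T (yCond φ j i j' i') → Vertex φ   -- vertex of V_2 for pair u^j_i, w^{j'}_{i'}
  py       : (j : Fin m) (i : Fin 3) (j' : Fin m) (i' : Fin 3) →
             T (yCond φ j i j' i') → Vertex φ   -- its pendant

-- The edges (each listed once, in one orientation).
data Edge {m : ℕ} (φ : CNF3 m) : Vertex φ → Vertex φ → Set where
  e-au  : ∀ j i → Edge φ va (u j i)
  e-uv  : ∀ j i → Edge φ (u j i) (v j i)
  e-vw  : ∀ j i → Edge φ (v j i) (w j i)
  e-wb  : ∀ j i → Edge φ (w j i) vb
  e-cu  : ∀ j i → positive (φ j i) ≡ false → Edge φ (c j) (u j i)
  e-cw  : ∀ j i → positive (φ j i) ≡ true  → Edge φ (c j) (w j i)
  e-yu  : ∀ j i j' i' p → Edge φ (y j i j' i' p) (u j i)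
  e-yw  : ∀ j i j' i' p → Edge φ (y j i j' i' p) (w j' i')
  e-apa : Edge φ va pa
  e-bpb : Edge φ vb pb
  e-vpv : ∀ j i → Edge φ (v j i) (pv j i)
  e-ypy : ∀ j i j' i' p → Edge φ (y j i j' i' p) (py j i j' i' p)

Adj : ∀ {m} (φ : CNF3 m) → Vertex φ → Vertex φ → Set
Adj φ x z = Edge φ x z ⊎ Edge φ z x

VSet : ∀ {m} → CNF3 m → Set
VSet φ = Vertex φ → Bool

data Reach {m : ℕ} (φ : CNF3 m) (S : VSet φ) : Vertex φ → Vertex φ → Set where
  here : ∀ {x} → S x ≡ false → Reach φ S x x
  step : ∀ {x z t} → S x ≡ false → Adj φ x z → Reach φ S z t → Reach φ S x t

Separates : ∀ {m} (φ : CNF3 m) → VSet φ → Vertex φ → Vertex φ → Set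
Separates φ S x z = S x ≡ false × S z ≡ false × ¬ Reach φ S x z

IsSeparator : ∀ {m} (φ : CNF3 m) → VSet φ → Set
IsSeparator φ S = Σ (Vertex φ) λ x → Σ (Vertex φ) λ z → Separates φ S x z

_⊆_ : ∀ {m} {φ : CNF3 m} → VSet φ → VSet φ → Set
T ⊆ S = ∀ x → T x ≡ true → S x ≡ true

_⊂_ : ∀ {m} {φ : CNF3 m} → VSet φ → VSet φ → Set
T ⊂ S = T ⊆ S × Σ _ λ x → S x ≡ true × T x ≡ false

IsMinimalSeparator : ∀ {m} (φ : CNF3 m) → VSet φ → Set
IsMinimalSeparator φ S = IsSeparator φ S × ((T : VSet φ) → T ⊂ S → ¬ IsSeparator φ T)

AtLeast4 : ∀ {m} {φ : CNF3 m} → VSet φ → Set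
AtLeast4 {φ = φ} S =
  Σ (Vertex φ) λ x₁ → Σ (Vertex φ) λ x₂ → Σ (Vertex φ) λ x₃ → Σ (Vertex φ) λ x₄ →
    (S x₁ ≡ true × S x₂ ≡ true × S x₃ ≡ true × S x₄ ≡ true) ×
    (x₁ ≢ x₂ × x₁ ≢ x₃ × x₁ ≢ x₄ × x₂ ≢ x₃ × x₂ ≢ x₄ × x₃ ≢ x₄)

data IsCUW {m : ℕ} {φ : CNF3 m} : Vertex φ → Set where
  isC : ∀ j → IsCUW (c j)
  isU : ∀ j i → IsCUW (u j i)
  isW : ∀ j i → IsCUW (w j i)

{-# OPTIONS --safe #-}
module Submission where

-- Removing any s from the minimal separator S reconnects its two sides, so every
-- component of G - S is attached to every vertex of S. A vertex set closed under
-- adjacency in G - S with at most three attachments therefore contradicts |S| ≥ 4;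
-- this keeps a, b, the middle vertices, V₂ and all pendants out of S and gives every
-- c_j a neighbour outside S. Hence every vertex outside S reaches a or b in G - S,
-- while a and b are separated. Making a variable true exactly when one of its
-- positive occurrences has its w-vertex outside S satisfies every clause through
-- the free neighbour of its c_j: a free u of a negative literal whose variable is
-- made true by another clause would give a path a u y w b through V₂.

open import Defs
open import Data.Nat as ℕ using (ℕ; _≤_)
open import Data.Nat.Properties using (≡⇒≡ᵇ; n<1+n)
open import Data.Bool as Bool using (Bool; true; false; T; not; if_then_else_)
open import Data.Bool.Properties using (¬-not; T-∧; T-irrelevant)
open import Data.Fin using (Fin; zero; suc)
open import Data.Fin.Properties using (_≟_; any?; ¬∀⟶∃¬; pigeonhole; <⇒≢)
open import Data.Vec using ([]; _∷_; lookup)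
open import Data.Product using (Σ; ∃; ∃₂; _×_; _,_; proj₁; proj₂; map₂)
open import Data.Product.Properties as Product using ()
open import Data.Sum as Sum using (_⊎_; inj₁; inj₂; [_,_]′)
open import Data.Sum.Properties as Sum using ()
open import Data.Empty using (⊥; ⊥-elim)
open import Function using (_∘_; id; const; Equivalence)
open import Function.Definitions using (Injective)
open import Relation.Nullary using (¬_; yes; no; does; map′; _×-dec_)
open import Relation.Nullary.Negation using (contradiction; ¬¬-map)
open import Relation.Nullary.Decidable using (dec-true; dec-false; fromWitnessFalse)
open import Relation.Unary using (Decidable)
open import Relation.Binary using (DecidableEquality)
open import Relation.Binary.PropositionalEquality using (_≡_; refl; sym; trans; cong; subst)

¬¬-∀-Fin : ∀ {n} {P : Fin n → Set} → (∀ k → ¬ ¬ P k) → ¬ ¬ (∀ k → P k)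
¬¬-∀-Fin {ℕ.zero}  _  ¬all = ¬all λ ()
¬¬-∀-Fin {ℕ.suc n} ¬¬P ¬all =
  ¬¬P zero λ P₀ → ¬¬-∀-Fin (¬¬P ∘ suc) λ P₊ → ¬all λ { zero → P₀ ; (suc k) → P₊ k }

_∈-image_ : {A : Set} {n : ℕ} → A → (Fin n → A) → Set
x ∈-image f = ∃ λ k → x ≡ f k

injective⇒¬⊆-image : ∀ {A : Set} {k n} {xs : Fin n → A} {f : Fin k → A} → k ℕ.< n →
                     Injective _≡_ _≡_ xs → ¬ (∀ i → xs i ∈-image f)
injective⇒¬⊆-image {xs = xs} {f} k<n xs-injective covered
  with i , j , i<j , same ← pigeonhole k<n (proj₁ ∘ covered) =
  <⇒≢ i<j (xs-injective (trans (proj₂ (covered i)) (trans (cong f same) (sym (proj₂ (covered j))))))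

module _ {m : ℕ} {φ : CNF3 m} where

  -- A flat encoding of the vertices, through which they inherit decidable equality.
  private
    YIndex : Set
    YIndex = Σ (Fin m × Fin 3 × Fin m × Fin 3) λ (j , i , j′ , i′) → T (yCond φ j i j′ i′)

    Code : Set
    Code = Fin 4 ⊎ (Fin 4 × Fin m × Fin 3) ⊎ Fin m ⊎ (Bool × YIndex)

    _≟ᶜ_ : DecidableEquality Code
    _≟ᶜ_ = Sum.≡-dec _≟_ (Sum.≡-dec (Product.≡-dec _≟_ (Product.≡-dec _≟_ _≟_))
             (Sum.≡-dec _≟_ (Product.≡-dec Bool._≟_ (Product.≡-dec
               (Product.≡-dec _≟_ (Product.≡-dec _≟_ (Product.≡-dec _≟_ _≟_)))
               λ p q → yes (T-irrelevant p q)))))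

    encode : Vertex φ → Code
    encode va = inj₁ zero
    encode vb = inj₁ (suc zero)
    encode pa = inj₁ (suc (suc zero))
    encode pb = inj₁ (suc (suc (suc zero)))
    encode (u j i) = inj₂ (inj₁ (zero , j , i))
    encode (v j i) = inj₂ (inj₁ (suc zero , j , i))
    encode (w j i) = inj₂ (inj₁ (suc (suc zero) , j , i))
    encode (pv j i) = inj₂ (inj₁ (suc (suc (suc zero)) , j , i))
    encode (c j) = inj₂ (inj₂ (inj₁ j))
    encode (y j i j′ i′ p) = inj₂ (inj₂ (inj₂ (true , (j , i , j′ , i′) , p)))
    encode (py j i j′ i′ p) = inj₂ (inj₂ (inj₂ (false , (j , i , j′ , i′) , p)))

    decode : Code → Vertex φ
    decode (inj₁ zero) = va
    decode (inj₁ (suc zero)) = vb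
    decode (inj₁ (suc (suc zero))) = pa
    decode (inj₁ (suc (suc (suc zero)))) = pb
    decode (inj₂ (inj₁ (zero , j , i))) = u j i
    decode (inj₂ (inj₁ (suc zero , j , i))) = v j i
    decode (inj₂ (inj₁ (suc (suc zero) , j , i))) = w j i
    decode (inj₂ (inj₁ (suc (suc (suc zero)) , j , i))) = pv j i
    decode (inj₂ (inj₂ (inj₁ j))) = c j
    decode (inj₂ (inj₂ (inj₂ (true , (j , i , j′ , i′) , p)))) = y j i j′ i′ p
    decode (inj₂ (inj₂ (inj₂ (false , (j , i , j′ , i′) , p)))) = py j i j′ i′ p

    decode-encode : ∀ x → decode (encode x) ≡ x
    decode-encode va = refl
    decode-encode vb = refl
    decode-encode pa = refl
    decode-encode pb = refl
    decode-encode (u j i) = refl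
    decode-encode (v j i) = refl
    decode-encode (w j i) = refl
    decode-encode (pv j i) = refl
    decode-encode (c j) = refl
    decode-encode (y j i j′ i′ p) = refl
    decode-encode (py j i j′ i′ p) = refl

    encode-injective : Injective _≡_ _≡_ encode
    encode-injective {x} {z} e = trans (sym (decode-encode x)) (trans (cong decode e) (decode-encode z))

  -- Opaque, so that `with x ≟ᵥ s` can abstract over the occurrence inside (S ─ s) x.
  opaque
    _≟ᵥ_ : DecidableEquality (Vertex φ)
    x ≟ᵥ z = map′ encode-injective (cong encode) (encode x ≟ᶜ encode z)

  Adj-sym : ∀ {x z} → Adj φ x z → Adj φ z x
  Adj-sym = Sum.swap

  Reach-start : ∀ {S : VSet φ} {x t} → Reach φ S x t → S x ≡ false
  Reach-start (here x∉S) = x∉S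
  Reach-start (step x∉S _ _) = x∉S

  Reach-end : ∀ {S : VSet φ} {x t} → Reach φ S x t → S t ≡ false
  Reach-end (here t∉S) = t∉S
  Reach-end (step _ _ r) = Reach-end r

  Reach-trans : ∀ {S : VSet φ} {x z t} → Reach φ S x z → Reach φ S z t → Reach φ S x t
  Reach-trans (here _) r = r
  Reach-trans (step x∉S x-z r) r′ = step x∉S x-z (Reach-trans r r′)

  Reach-sym : ∀ {S : VSet φ} {x t} → Reach φ S x t → Reach φ S t x
  Reach-sym (here x∉S) = here x∉S
  Reach-sym (step x∉S x-z r) = Reach-trans (Reach-sym r) (step (Reach-start r) (Adj-sym x-z) (here x∉S))

  Reach-split : ∀ {S T : VSet φ} {s p t} → (∀ {z} → T z ≡ false → S z ≡ true → z ≡ s) →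
                Reach φ T p t → S p ≡ false →
                Reach φ S p t ⊎ ∃ λ n → Reach φ S p n × Adj φ n s
  Reach-split only (here _) p∉S = inj₁ (here p∉S)
  Reach-split {S = S} {p = p} only (step {z = z} _ p-z z~t) p∉S with S z in z∈S
  ... | true = inj₂ (p , here p∉S , subst (Adj φ p) (only (Reach-start z~t) z∈S) p-z)
  ... | false = Sum.map (step p∉S p-z) (map₂ λ (n~ , adj) → step p∉S p-z n~ , adj) (Reach-split only z~t z∈S)

  _─_ : VSet φ → Vertex φ → VSet φ
  (S ─ s) x = if does (x ≟ᵥ s) then false else S x

  ─⊂ : ∀ {S s} → S s ≡ true → (S ─ s) ⊂ S
  ─⊂ {S} {s} s∈S = ⊆ , s , s∈S , removed
    where
      ⊆ : (S ─ s) ⊆ S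
      ⊆ x x∈ with x ≟ᵥ s
      ... | no _ = x∈
      removed : (S ─ s) s ≡ false
      removed with s ≟ᵥ s
      ... | yes _ = refl
      ... | no s≢s = contradiction refl s≢s

  ─-outside : ∀ {x} S s → S x ≡ false → (S ─ s) x ≡ false
  ─-outside {x} S s x∉S with x ≟ᵥ s
  ... | yes _ = refl
  ... | no _ = x∉S

  ─-removed : ∀ {z} S s → (S ─ s) z ≡ false → S z ≡ true → z ≡ s
  ─-removed {z} S s z∉ z∈S with z ≟ᵥ s
  ... | yes z≡s = z≡s
  ... | no _ = contradiction (trans (sym z∉) z∈S) λ ()

module MinimalSeparator {m : ℕ} {φ : CNF3 m} {S : VSet φ} {x₀ z₀ : Vertex φ}
    (x₀∉S : S x₀ ≡ false) (z₀∉S : S z₀ ≡ false) (x₀≁z₀ : ¬ Reach φ S x₀ z₀)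
    (minimal : (T : VSet φ) → T ⊂ S → ¬ IsSeparator φ T) where

  outside : ∀ {x} {A : Set} → S x ≡ false → S x ≡ true → A
  outside x∉S x∈S = contradiction (trans (sym x∉S) x∈S) λ ()

  Pendant : Vertex φ → Vertex φ → Set
  Pendant p x = ∀ {n} → Adj φ p n → n ≡ x

  -- S ─ s is not a separator, so x reaches x₀ and z₀ in G - (S ─ s); if neither path
  -- met s, x₀ and z₀ would be connected in G - S.
  attached-from : ∀ {s x} → S s ≡ true → S x ≡ false → ¬ ¬ (∃ λ n → Reach φ S x n × Adj φ n s)
  attached-from {s} {x} s∈S x∉S unattached =
    reaches x₀∉S λ x~x₀ → reaches z₀∉S λ x~z₀ →
      [ (λ x~x₀ → [ (λ x~z₀ → x₀≁z₀ (Reach-trans (Reach-sym x~x₀) x~z₀)) , unattached ]′ (split x~z₀))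
      , unattached ]′ (split x~x₀)
    where
      reaches : ∀ {t} → S t ≡ false → ¬ ¬ Reach φ (S ─ s) x t
      reaches {t} t∉S ¬x~t = minimal (S ─ s) (─⊂ s∈S) (x , t , ─-outside S s x∉S , ─-outside S s t∉S , ¬x~t)
      split : ∀ {t} → Reach φ (S ─ s) x t → Reach φ S x t ⊎ ∃ λ n → Reach φ S x n × Adj φ n s
      split x~t = Reach-split (─-removed S s) x~t x∉S

  leaf∉S : ∀ {p x} → Pendant p x → S p ≡ false
  leaf∉S {p} {x} pendant = ¬-not λ p∈S →
    attached-from p∈S x₀∉S λ (_ , x₀~n , n-p) → attached-from p∈S z₀∉S λ (_ , z₀~n′ , n′-p) →
      x₀≁z₀ (Reach-trans (to-x x₀~n n-p) (Reach-sym (to-x z₀~n′ n′-p)))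
    where
      to-x : ∀ {t n} → Reach φ S t n → Adj φ n p → Reach φ S t x
      to-x t~n n-p = subst (Reach φ S _) (pendant (Adj-sym n-p)) t~n

  Closed : (Vertex φ → Set) → Set
  Closed R = ∀ {p q} → R p → Adj φ p q → S q ≡ false → R q

  AttachedWithin : (Vertex φ → Set) → (Fin 3 → Vertex φ) → Set
  AttachedWithin R f = ∀ {n s} → R n → Adj φ n s → S s ≡ true → s ∈-image f

  Closed-Reach : ∀ {R x n} → Closed R → R x → Reach φ S x n → R n
  Closed-Reach closed Rx (here _) = Rx
  Closed-Reach closed Rx (step _ x-z r) = Closed-Reach closed (closed Rx x-z (Reach-start r)) r

  module FourElements (xs : Fin 4 → Vertex φ) (xs∈S : ∀ k → S (xs k) ≡ true)
                      (xs-injective : Injective _≡_ _≡_ xs) where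

    -- Each component of G - S is attached to all four xs k, which cannot fit in three vertices.
    ¬attached-within-three : ∀ {R f x} → Closed R → AttachedWithin R f → R x → S x ≡ false → ⊥
    ¬attached-within-three {R} {f} {x} closed within Rx x∉S =
      ¬¬-∀-Fin (λ k → ¬¬-map (attachment k) (attached-from (xs∈S k) x∉S))
               (injective⇒¬⊆-image (n<1+n 3) xs-injective)
      where
        attachment : ∀ k → (∃ λ n → Reach φ S x n × Adj φ n (xs k)) → xs k ∈-image f
        attachment k (_ , x~n , n-xs) = within (Closed-Reach closed Rx x~n) n-xs (xs∈S k)

    support∉S : ∀ {p x} → Pendant p x → S x ≡ false
    support∉S {p} {x} pendant = ¬-not λ x∈S → ¬attached-within-three (closed x∈S) within refl (leaf∉S pendant)
      where
        closed : S x ≡ true → Closed (_≡ p)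
        closed x∈S refl p-q q∉S = outside q∉S (trans (cong S (pendant p-q)) x∈S)
        within : AttachedWithin (_≡ p) (const x)
        within refl p-s _ = zero , pendant p-s

    -- A vertex carrying a pendant whose two other neighbours both lie in S forms, with the
    -- pendant, a component attached to at most three vertices.
    hub-side∉S : ∀ {x p s₁ s₂} → Pendant p x →
                 (∀ {n} → Adj φ x n → n ∈-image lookup (s₁ ∷ s₂ ∷ p ∷ [])) →
                 S s₁ ≡ false ⊎ S s₂ ≡ false
    hub-side∉S {x} {p} {s₁} {s₂} pendant neighbours with S s₁ in s₁∈S | S s₂ in s₂∈S
    ... | false | _ = inj₁ refl
    ... | true | false = inj₂ refl
    ... | true | true = ⊥-elim (¬attached-within-three closed within (inj₁ refl) (support∉S pendant))
      where
        R : Vertex φ → Set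
        R n = n ≡ x ⊎ n ≡ p
        closed : Closed R
        closed (inj₁ refl) x-q q∉S with neighbours x-q
        ... | zero , refl = outside q∉S s₁∈S
        ... | suc zero , refl = outside q∉S s₂∈S
        ... | suc (suc zero) , refl = inj₂ refl
        closed (inj₂ refl) p-q _ = inj₁ (pendant p-q)
        within : AttachedWithin R (lookup (s₁ ∷ s₂ ∷ p ∷ []))
        within (inj₁ refl) x-s _ = neighbours x-s
        within (inj₂ refl) p-s s∈S =
          outside (support∉S pendant) (trans (cong S (sym (pendant p-s))) s∈S)

    pa-pendant : Pendant pa va
    pa-pendant (inj₂ e-apa) = refl

    pb-pendant : Pendant pb vb
    pb-pendant (inj₂ e-bpb) = refl

    pv-pendant : ∀ {j i} → Pendant (pv j i) (v j i)
    pv-pendant (inj₂ (e-vpv _ _)) = refl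

    py-pendant : ∀ {j i j′ i′ p} → Pendant (py j i j′ i′ p) (y j i j′ i′ p)
    py-pendant (inj₂ (e-ypy _ _ _ _ _)) = refl

    a∉S : S va ≡ false
    a∉S = support∉S pa-pendant

    b∉S : S vb ≡ false
    b∉S = support∉S pb-pendant

    y∉S : ∀ {j i j′ i′ p} → S (y j i j′ i′ p) ≡ false
    y∉S = support∉S py-pendant

    S⊆CUW : (x : Vertex φ) → S x ≡ true → IsCUW x
    S⊆CUW va = outside a∉S
    S⊆CUW vb = outside b∉S
    S⊆CUW pa = outside (leaf∉S pa-pendant)
    S⊆CUW pb = outside (leaf∉S pb-pendant)
    S⊆CUW (u j i) _ = isU j i
    S⊆CUW (v j i) = outside (support∉S pv-pendant)
    S⊆CUW (w j i) _ = isW j i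
    S⊆CUW (pv j i) = outside (leaf∉S pv-pendant)
    S⊆CUW (c j) _ = isC j
    S⊆CUW (y j i j′ i′ p) = outside y∉S
    S⊆CUW (py j i j′ i′ p) = outside (leaf∉S py-pendant)

    ReachesAB : Vertex φ → Set
    ReachesAB x = Reach φ S x va ⊎ Reach φ S x vb

    via : ∀ {x z} → S x ≡ false → Adj φ x z → ReachesAB z → ReachesAB x
    via x∉S x-z = Sum.map (step x∉S x-z) (step x∉S x-z)

    u-reaches : ∀ {j i} → S (u j i) ≡ false → ReachesAB (u j i)
    u-reaches u∉S = inj₁ (step u∉S (inj₂ (e-au _ _)) (here a∉S))

    w-reaches : ∀ {j i} → S (w j i) ≡ false → ReachesAB (w j i)
    w-reaches w∉S = inj₂ (step w∉S (inj₁ (e-wb _ _)) (here b∉S))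

    v-reaches : ∀ j i → ReachesAB (v j i)
    v-reaches j i = [ via v∉S (inj₂ (e-uv j i)) ∘ u-reaches , via v∉S (inj₁ (e-vw j i)) ∘ w-reaches ]′
                      (hub-side∉S pv-pendant neighbours)
      where
        v∉S = support∉S pv-pendant
        neighbours : ∀ {n} → Adj φ (v j i) n → n ∈-image lookup (u j i ∷ w j i ∷ pv j i ∷ [])
        neighbours (inj₁ (e-vw _ _)) = suc zero , refl
        neighbours (inj₁ (e-vpv _ _)) = suc (suc zero) , refl
        neighbours (inj₂ (e-uv _ _)) = zero , refl

    y-reaches : ∀ j i j′ i′ p → ReachesAB (y j i j′ i′ p)
    y-reaches j i j′ i′ p = [ via y∉S (inj₁ (e-yu j i j′ i′ p)) ∘ u-reaches
                            , via y∉S (inj₁ (e-yw j i j′ i′ p)) ∘ w-reaches ]′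
                              (hub-side∉S py-pendant neighbours)
      where
        neighbours : ∀ {n} → Adj φ (y j i j′ i′ p) n →
                     n ∈-image lookup (u j i ∷ w j′ i′ ∷ py j i j′ i′ p ∷ [])
        neighbours (inj₁ (e-yu _ _ _ _ _)) = zero , refl
        neighbours (inj₁ (e-yw _ _ _ _ _)) = suc zero , refl
        neighbours (inj₁ (e-ypy _ _ _ _ _)) = suc (suc zero) , refl

    attach : Fin m → Fin 3 → Vertex φ
    attach j i = if positive (φ j i) then w j i else u j i

    attach-w : ∀ {j i} → positive (φ j i) ≡ true → attach j i ≡ w j i
    attach-w pos rewrite pos = refl

    attach-u : ∀ {j i} → positive (φ j i) ≡ false → attach j i ≡ u j i
    attach-u neg rewrite neg = refl

    attach-reaches : ∀ {j i} → S (attach j i) ≡ false → ReachesAB (attach j i)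
    attach-reaches {j} {i} with positive (φ j i)
    ... | true = w-reaches
    ... | false = u-reaches

    c-attach : ∀ j i → Adj φ (c j) (attach j i)
    c-attach j i with positive (φ j i) in pos
    ... | true = inj₁ (e-cw j i pos)
    ... | false = inj₁ (e-cu j i pos)

    c-neighbours : ∀ {j n} → Adj φ (c j) n → n ∈-image attach j
    c-neighbours (inj₁ (e-cu _ i neg)) = i , sym (attach-u neg)
    c-neighbours (inj₁ (e-cw _ i pos)) = i , sym (attach-w pos)

    clause-free-attachment : ∀ j → ∃ λ i → S (attach j i) ≡ false
    clause-free-attachment j = map₂ ¬-not (¬∀⟶∃¬ 3 _ (λ i → S (attach j i) Bool.≟ true) ¬all-attached)
      where
        ¬all-attached : ¬ (∀ i → S (attach j i) ≡ true)
        ¬all-attached all with S (c j) in c∈S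
        ... | true = attached-from c∈S a∉S λ (_ , a~n , n-c) →
                       let i , n≡ = c-neighbours (Adj-sym n-c)
                       in outside (Reach-end a~n) (trans (cong S n≡) (all i))
        ... | false = ¬attached-within-three closed within refl c∈S
          where
            closed : Closed (_≡ c j)
            closed refl c-q q∉S = let i , q≡ = c-neighbours c-q in outside q∉S (trans (cong S q≡) (all i))
            within : AttachedWithin (_≡ c j) (attach j)
            within refl c-s _ = c-neighbours c-s

    reaches-a-or-b : ∀ x → S x ≡ false → ReachesAB x
    reaches-a-or-b va a∉S = inj₁ (here a∉S)
    reaches-a-or-b vb b∉S = inj₂ (here b∉S)
    reaches-a-or-b pa pa∉S = via pa∉S (inj₂ e-apa) (inj₁ (here a∉S))
    reaches-a-or-b pb pb∉S = via pb∉S (inj₂ e-bpb) (inj₂ (here b∉S))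
    reaches-a-or-b (u j i) u∉S = u-reaches u∉S
    reaches-a-or-b (v j i) _ = v-reaches j i
    reaches-a-or-b (w j i) w∉S = w-reaches w∉S
    reaches-a-or-b (pv j i) pv∉S = via pv∉S (inj₂ (e-vpv j i)) (v-reaches j i)
    reaches-a-or-b (c j) c∉S =
      let i , free = clause-free-attachment j in via c∉S (c-attach j i) (attach-reaches free)
    reaches-a-or-b (y j i j′ i′ p) _ = y-reaches j i j′ i′ p
    reaches-a-or-b (py j i j′ i′ p) py∉S = via py∉S (inj₂ (e-ypy j i j′ i′ p)) (y-reaches j i j′ i′ p)

    a≁b : ¬ Reach φ S va vb
    a≁b a~b = x₀≁z₀ (Reach-trans (to-a (reaches-a-or-b x₀ x₀∉S)) (Reach-sym (to-a (reaches-a-or-b z₀ z₀∉S))))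
      where
        to-a : ∀ {x} → ReachesAB x → Reach φ S x va
        to-a = [ id , (λ x~b → Reach-trans x~b (Reach-sym a~b)) ]′

    conflict-path : ∀ {j i j′ i′} → T (yCond φ j i j′ i′) → S (u j i) ≡ false → S (w j′ i′) ≡ false →
                    Reach φ S va vb
    conflict-path p u∉S w∉S =
      step a∉S (inj₁ (e-au _ _)) (step u∉S (inj₂ (e-yu _ _ _ _ p))
        (step y∉S (inj₁ (e-yw _ _ _ _ p)) (step w∉S (inj₁ (e-wb _ _)) (here b∉S))))

    FreePositive : ℕ → Set
    FreePositive x = ∃₂ λ j i → var (φ j i) ≡ x × positive (φ j i) ≡ true × S (w j i) ≡ false

    free-positive? : Decidable FreePositive
    free-positive? x = any? λ j → any? λ i →
      var (φ j i) ℕ.≟ x ×-dec positive (φ j i) Bool.≟ true ×-dec S (w j i) Bool.≟ false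

    σ : Assignment
    σ x = does (free-positive? x)

    evalLit-positive : ∀ {l} → positive l ≡ true → evalLit σ l ≡ σ (var l)
    evalLit-positive {lit _ true} refl = refl

    evalLit-negative : ∀ {l} → positive l ≡ false → evalLit σ l ≡ not (σ (var l))
    evalLit-negative {lit _ false} refl = refl

    free-positive-true : ∀ {j i} → positive (φ j i) ≡ true → S (w j i) ≡ false → evalLit σ (φ j i) ≡ true
    free-positive-true {j} {i} pos free =
      trans (evalLit-positive pos) (dec-true (free-positive? _) (j , i , refl , pos , free))

    satisfied : ∀ j → ∃ λ i → evalLit σ (φ j i) ≡ true
    satisfied j with clause-free-attachment j
    ... | i , free with positive (φ j i) in pos
    ...   | true = i , free-positive-true pos free
    ...   | false with free-positive? (var (φ j i))
    ...     | no ¬fp = i , trans (evalLit-negative pos) (cong not (dec-false (free-positive? _) ¬fp))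
    ...     | yes (j′ , i′ , same-var , pos′ , free′) with j ≟ j′
    ...       | yes refl = i′ , free-positive-true pos′ free′
    ...       | no j≢j′ = ⊥-elim (a≁b (conflict-path conflicting free free′))
      where
        conflicting : T (yCond φ j i j′ i′)
        conflicting = Equivalence.from T-∧ (≡⇒≡ᵇ _ _ (sym same-var) , fromWitnessFalse j≢j′)

AtLeast4⇒injection : ∀ {m} {φ : CNF3 m} {S : VSet φ} → AtLeast4 S →
                     Σ (Fin 4 → Vertex φ) λ xs → (∀ k → S (xs k) ≡ true) × Injective _≡_ _≡_ xs
AtLeast4⇒injection (x₁ , x₂ , x₃ , x₄ , (x₁∈ , x₂∈ , x₃∈ , x₄∈) , (d₁₂ , d₁₃ , d₁₄ , d₂₃ , d₂₄ , d₃₄)) =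
  lookup xs , (λ { zero → x₁∈ ; (suc zero) → x₂∈ ; (suc (suc zero)) → x₃∈ ; (suc (suc (suc zero))) → x₄∈ }) , injective
  where
    xs = x₁ ∷ x₂ ∷ x₃ ∷ x₄ ∷ []
    injective : Injective _≡_ _≡_ (lookup xs)
    injective {zero} {zero} _ = refl
    injective {zero} {suc zero} e = contradiction e d₁₂
    injective {zero} {suc (suc zero)} e = contradiction e d₁₃
    injective {zero} {suc (suc (suc zero))} e = contradiction e d₁₄
    injective {suc zero} {zero} e = contradiction (sym e) d₁₂
    injective {suc zero} {suc zero} _ = refl
    injective {suc zero} {suc (suc zero)} e = contradiction e d₂₃
    injective {suc zero} {suc (suc (suc zero))} e = contradiction e d₂₄
    injective {suc (suc zero)} {zero} e = contradiction (sym e) d₁₃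
    injective {suc (suc zero)} {suc zero} e = contradiction (sym e) d₂₃
    injective {suc (suc zero)} {suc (suc zero)} _ = refl
    injective {suc (suc zero)} {suc (suc (suc zero))} e = contradiction e d₃₄
    injective {suc (suc (suc zero))} {zero} e = contradiction (sym e) d₁₄
    injective {suc (suc (suc zero))} {suc zero} e = contradiction (sym e) d₂₄
    injective {suc (suc (suc zero))} {suc (suc zero)} e = contradiction (sym e) d₃₄
    injective {suc (suc (suc zero))} {suc (suc (suc zero))} _ = refl

lemma1 : (m : ℕ) → 2 ≤ m → (φ : CNF3 m) → (S : VSet φ) →
         IsMinimalSeparator φ S → AtLeast4 S →
         ((x : Vertex φ) → S x ≡ true → IsCUW x) × Satisfiable φ
lemma1 m _ φ S ((x₀ , z₀ , x₀∉S , z₀∉S , x₀≁z₀) , minimal) four =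
  let xs , xs∈S , xs-injective = AtLeast4⇒injection four
      open MinimalSeparator x₀∉S z₀∉S x₀≁z₀ minimal
      open FourElements xs xs∈S xs-injective
  in S⊆CUW , σ , satisfied
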